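{- In the deductive system AML, for all terms $A$ the following atomic formulas are derivable (with no undischarged hypotheses): (i) $\ominus A \rightarrow \lozenge A^c$; (ii) $A \rightarrow \lozenge A$; (iii) $\ominus A \rightarrow \lozenge A$; (iv) $\square A^c \rightarrow \sqcup A$; (v) $\lozenge\lozenge A \rightarrow \lozenge A$; (vi) $\lozenge \ominus A \rightarrow \ominus A$; (vii) $\lozenge \square A \rightarrow \lozenge A$. Moreover, the following rules are derivable in AML (i.e. for all terms $A,B$ the conclusion is derivable from the premises): ($\ominus$Ex) from a formula infer any formula obtained from it by replacing any number of occurrences of a subterm $\ominus C$ by $\ominus C^c$, or of $\ominus C^c$ by $\ominus C$; ($\star\lozenge$) from $\star A$ infer $\star \lozenge A$; ($\star\square$) from $\star \square A$ infer $\star A$; ($\rightarrow$W) from $\star A$ and $A\rightarrow B$ infer $A \rightsquigarrow B$; ($\ominus$I) from $A\rightarrow \lozenge B$ and $A\rightarrow \lozenge B^c$ infer $A\rightarrow \ominus B$; ($\lozenge$T) from $A\rightarrow B$ infer $\lozenge A\rightarrow \lozenge B$; from $A\rightarrow \lozenge B$ infer $\lozenge A\rightarrow \lozenge B$; ($\rightsquigarrow$K) from $A\rightsquigarrow B$ infer $\lozenge A\rightsquigarrow \lozenge B$; from $A\rightarrow \square B$ infer $\square A\rightarrow \square B$.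
   Context: Aristotelic Modal Logic (AML). Fix a countable set $T$ of atomic terms. Terms: every atomic term is a term; if $A$ is a term then $A^c$, $\square A$ and $\sqcup A$ are terms. Atomic formulas: for terms $A,B$, $A\rightarrow B$ (universal) and $A\rightsquigarrow B$ (particular). Formulas: atomic formulas, and $\phi \,\&\, \psi$, $\phi \Rightarrow \psi$ for formulas $\phi,\psi$. Abbreviations: $\lozenge A := (\square (A^c))^c$, $\ominus A := (\sqcup A)^c$, $\star A := A\rightsquigarrow A$. Deductive system (natural deduction): rules of minimal propositional logic: MP (from $\phi$ and $\phi\Rightarrow\psi$ infer $\psi$), $\Rightarrow$I (from a derivation of $\psi$ from hypothesis $\phi$ infer $\phi\Rightarrow\psi$, discharging $\phi$), $\&$I (from $\phi,\psi$ infer $\phi\,\&\,\psi$), $\&$E (from $\phi_1\,\&\,\phi_2$ infer $\phi_i$, $i=1,2$). Term rules: cEx: from a formula infer any formula obtained by replacing any number of occurrences of a subterm $C^{cc}$ by $C$ or of a subterm $C$ by $C^{cc}$; $\sqcup$Ex: from a formula infer any formula obtained by replacing any number of occurrences of $\sqcup C^c$ by $\sqcup C$ or of $\sqcup C$ by $\sqcup C^c$; $\rightarrow$T: from $A\rightarrow B$ and $B\rightarrow C$ infer $A\rightarrow C$; $\rightsquigarrow$C: from $A\rightsquigarrow B$ infer $B\rightsquigarrow A$; $\rightsquigarrow$I: from $A\rightsquigarrow B$ infer $A\rightsquigarrow A$; $\rightsquigarrow$T: from $A\rightsquigarrow B$ and $B\rightarrow C$ infer $A\rightsquigarrow C$;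 cC: from $A\rightarrow B^c$ infer $B\rightarrow A^c$; K: from $A\rightarrow B$ infer $\square A\rightarrow\square B$; $\sqcup$I: from $\square A\rightarrow B$ and $\square A^c \rightarrow B$ infer $\sqcup A\rightarrow B$. Axioms (for all terms $A$): (S) $\square A\rightarrow \sqcup A$; (T) $\square A\rightarrow A$; (4) $\square A\rightarrow \square\square A$. Rule K may be applied without restriction on hypotheses. -}

module Defs where

open import Data.List using (List; []; _∷_)
open import Data.List.Membership.Propositional using (_∈_)

infix 9 _ᶜ
infix 8 □_ ⊔_ ◇_ ⊖_

data Term (T : Set) : Set where
  atom : T → Term T
  _ᶜ   : Term T → Term T
  □_   : Term T → Term T
  ⊔_   : Term T → Term T

◇_ : {T : Set} → Term T → Term T
◇ A = (□ (A ᶜ)) ᶜ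

⊖_ : {T : Set} → Term T → Term T
⊖ A = (⊔ A) ᶜ

infix 4 _⟶_ _⇝_
infixr 3 _&_
infixr 2 _⇒_

data Formula (T : Set) : Set where
  _⟶_ : Term T → Term T → Formula T
  _⇝_ : Term T → Term T → Formula T
  _&_ : Formula T → Formula T → Formula T
  _⇒_ : Formula T → Formula T → Formula T

⋆_ : {T : Set} → Term T → Formula T
⋆ A = A ⇝ A

-- Replacement relations on terms ("replace any number of occurrences").
infix 4 _≈c_ _≈u_ _≈o_

data _≈c_ {T : Set} : Term T → Term T → Set where
  atm   : ∀ a → atom a ≈c atom a
  cngᶜ  : ∀ {A B} → A ≈c B → A ᶜ ≈c B ᶜ
  cng□  : ∀ {A B} → A ≈c B → □ A ≈c □ B
  cng⊔  : ∀ {A B} → A ≈c B → ⊔ A ≈c ⊔ B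
  elim  : ∀ {A B} → A ≈c B → A ᶜ ᶜ ≈c B
  intro : ∀ {A B} → A ≈c B → A ≈c B ᶜ ᶜ

data _≈u_ {T : Set} : Term T → Term T → Set where
  atm   : ∀ a → atom a ≈u atom a
  cngᶜ  : ∀ {A B} → A ≈u B → A ᶜ ≈u B ᶜ
  cng□  : ∀ {A B} → A ≈u B → □ A ≈u □ B
  cng⊔  : ∀ {A B} → A ≈u B → ⊔ A ≈u ⊔ B
  elim  : ∀ {A B} → A ≈u B → ⊔ (A ᶜ) ≈u ⊔ B
  intro : ∀ {A B} → A ≈u B → ⊔ A ≈u ⊔ (B ᶜ)

data _≈o_ {T : Set} : Term T → Term T → Set where
  atm   : ∀ a → atom a ≈o atom a
  cngᶜ  : ∀ {A B} → A ≈o B → A ᶜ ≈o B ᶜ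
  cng□  : ∀ {A B} → A ≈o B → □ A ≈o □ B
  cng⊔  : ∀ {A B} → A ≈o B → ⊔ A ≈o ⊔ B
  elim  : ∀ {A B} → A ≈o B → ⊖ (A ᶜ) ≈o ⊖ B
  intro : ∀ {A B} → A ≈o B → ⊖ A ≈o ⊖ (B ᶜ)

data Lift {T : Set} (R : Term T → Term T → Set) : Formula T → Formula T → Set where
  univ : ∀ {A A′ B B′} → R A A′ → R B B′ → Lift R (A ⟶ B) (A′ ⟶ B′)
  part : ∀ {A A′ B B′} → R A A′ → R B B′ → Lift R (A ⇝ B) (A′ ⇝ B′)
  conj : ∀ {φ φ′ ψ ψ′} → Lift R φ φ′ → Lift R ψ ψ′ → Lift R (φ & ψ) (φ′ & ψ′)
  impl : ∀ {φ φ′ ψ ψ′} → Lift R φ φ′ → Lift R ψ ψ′ → Lift R (φ ⇒ ψ) (φ′ ⇒ ψ′)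

infix 1 _⊢_

data _⊢_ {T : Set} : List (Formula T) → Formula T → Set where
  hyp  : ∀ {Γ φ} → φ ∈ Γ → Γ ⊢ φ
  mp   : ∀ {Γ φ ψ} → Γ ⊢ φ → Γ ⊢ (φ ⇒ ψ) → Γ ⊢ ψ
  ⇒I   : ∀ {Γ φ ψ} → (φ ∷ Γ) ⊢ ψ → Γ ⊢ (φ ⇒ ψ)
  &I   : ∀ {Γ φ ψ} → Γ ⊢ φ → Γ ⊢ ψ → Γ ⊢ (φ & ψ)
  &E₁  : ∀ {Γ φ ψ} → Γ ⊢ (φ & ψ) → Γ ⊢ φ
  &E₂  : ∀ {Γ φ ψ} → Γ ⊢ (φ & ψ) → Γ ⊢ ψ
  cEx  : ∀ {Γ φ ψ} → Γ ⊢ φ → Lift _≈c_ φ ψ → Γ ⊢ ψ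
  ⊔Ex  : ∀ {Γ φ ψ} → Γ ⊢ φ → Lift _≈u_ φ ψ → Γ ⊢ ψ
  ⟶T   : ∀ {Γ A B C} → Γ ⊢ (A ⟶ B) → Γ ⊢ (B ⟶ C) → Γ ⊢ (A ⟶ C)
  ⇝C   : ∀ {Γ A B} → Γ ⊢ (A ⇝ B) → Γ ⊢ (B ⇝ A)
  ⇝I   : ∀ {Γ A B} → Γ ⊢ (A ⇝ B) → Γ ⊢ (A ⇝ A)
  ⇝T   : ∀ {Γ A B C} → Γ ⊢ (A ⇝ B) → Γ ⊢ (B ⟶ C) → Γ ⊢ (A ⇝ C)
  cC   : ∀ {Γ A B} → Γ ⊢ (A ⟶ B ᶜ) → Γ ⊢ (B ⟶ A ᶜ)
  K    : ∀ {Γ A B} → Γ ⊢ (A ⟶ B) → Γ ⊢ (□ A ⟶ □ B)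
  ⊔I   : ∀ {Γ A B} → Γ ⊢ (□ A ⟶ B) → Γ ⊢ (□ (A ᶜ) ⟶ B) → Γ ⊢ (⊔ A ⟶ B)
  axS  : ∀ {Γ A} → Γ ⊢ (□ A ⟶ ⊔ A)
  axT  : ∀ {Γ A} → Γ ⊢ (□ A ⟶ A)
  ax4  : ∀ {Γ A} → Γ ⊢ (□ A ⟶ □ □ A)

-- ◇ A = (□ Aᶜ)ᶜ and ⊖ A = (⊔ A)ᶜ are complements, so contraposing the axioms
-- T, 4, S (and the rules K, ⊔I) and removing double complements with cEx turns
-- facts about □ and ⊔ into the dual facts about ◇ and ⊖; ⊖Ex is ⊔Ex under a
-- complement. The ⋆ and ⇝ rules push a particular formula along universal ones
-- on both sides, using ⇝C to reach the second argument.
module Submission where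

open import Data.List using (List; []; _∷_)
open import Data.List.Relation.Unary.Any using (here; there)
open import Data.Product using (_×_; _,_)
open import Relation.Binary.PropositionalEquality using (refl)

open import Defs

module _ {T : Set} where

  ≈c-refl : (A : Term T) → A ≈c A
  ≈c-refl (atom a) = atm a
  ≈c-refl (A ᶜ)    = cngᶜ (≈c-refl A)
  ≈c-refl (□ A)    = cng□ (≈c-refl A)
  ≈c-refl (⊔ A)    = cng⊔ (≈c-refl A)

  ≈u-refl : (A : Term T) → A ≈u A
  ≈u-refl (atom a) = atm a
  ≈u-refl (A ᶜ)    = cngᶜ (≈u-refl A)
  ≈u-refl (□ A)    = cng□ (≈u-refl A)
  ≈u-refl (⊔ A)    = cng⊔ (≈u-refl A)

  ≈o⇒≈u : {A B : Term T} → A ≈o B → A ≈u B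
  ≈o⇒≈u (atm a)   = atm a
  ≈o⇒≈u (cngᶜ p)  = cngᶜ (≈o⇒≈u p)
  ≈o⇒≈u (cng□ p)  = cng□ (≈o⇒≈u p)
  ≈o⇒≈u (cng⊔ p)  = cng⊔ (≈o⇒≈u p)
  ≈o⇒≈u (elim p)  = cngᶜ (elim (≈o⇒≈u p))
  ≈o⇒≈u (intro p) = cngᶜ (intro (≈o⇒≈u p))

  Lift-map : {R S : Term T → Term T → Set} → (∀ {A B} → R A B → S A B) →
             {φ ψ : Formula T} → Lift R φ ψ → Lift S φ ψ
  Lift-map f (univ p q) = univ (f p) (f q)
  Lift-map f (part p q) = part (f p) (f q)
  Lift-map f (conj p q) = conj (Lift-map f p) (Lift-map f q)
  Lift-map f (impl p q) = impl (Lift-map f p) (Lift-map f q)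

  module _ {Γ : List (Formula T)} where

    ⊖Ex : {φ ψ : Formula T} → Γ ⊢ φ → Lift _≈o_ φ ψ → Γ ⊢ ψ
    ⊖Ex d p = ⊔Ex d (Lift-map ≈o⇒≈u p)

    ⟶-contrapose : {A B : Term T} → Γ ⊢ (A ⟶ B) → Γ ⊢ (B ᶜ ⟶ A ᶜ)
    ⟶-contrapose {A} {B} d = cC (cEx d (univ (≈c-refl A) (intro (≈c-refl B))))

    ⟶◇ : (A : Term T) → Γ ⊢ (A ⟶ ◇ A)
    ⟶◇ A = cC axT

    ◇-mono : {A B : Term T} → Γ ⊢ (A ⟶ B) → Γ ⊢ (◇ A ⟶ ◇ B)
    ◇-mono d = ⟶-contrapose (K (⟶-contrapose d))

    ◇◇⟶◇ : (A : Term T) → Γ ⊢ (◇ ◇ A ⟶ ◇ A)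
    ◇◇⟶◇ A = cEx (⟶-contrapose (ax4 {A = A ᶜ}))
                 (univ (cngᶜ (cng□ (intro (≈c-refl (□ (A ᶜ)))))) (≈c-refl (◇ A)))

    ◇-lift : {A B : Term T} → Γ ⊢ (A ⟶ ◇ B) → Γ ⊢ (◇ A ⟶ ◇ B)
    ◇-lift {B = B} d = ⟶T (◇-mono d) (◇◇⟶◇ B)

    □-lift : {A B : Term T} → Γ ⊢ (A ⟶ □ B) → Γ ⊢ (□ A ⟶ □ B)
    □-lift d = ⟶T (K d) axT

    ◇□⟶◇ : (A : Term T) → Γ ⊢ (◇ □ A ⟶ ◇ A)
    ◇□⟶◇ A = ◇-mono axT

    ⊖⟶◇ᶜ : (A : Term T) → Γ ⊢ (⊖ A ⟶ ◇ (A ᶜ))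
    ⊖⟶◇ᶜ A = cEx (⟶-contrapose axS)
                 (univ (≈c-refl (⊖ A)) (cngᶜ (cng□ (intro (≈c-refl A)))))

    □ᶜ⟶⊔ : (A : Term T) → Γ ⊢ (□ (A ᶜ) ⟶ ⊔ A)
    □ᶜ⟶⊔ A = ⊔Ex axS (univ (≈u-refl (□ (A ᶜ))) (elim (≈u-refl A)))

    ⊖⟶◇ : (A : Term T) → Γ ⊢ (⊖ A ⟶ ◇ A)
    ⊖⟶◇ A = ⟶-contrapose (□ᶜ⟶⊔ A)

    □⟶□⊔ : (A : Term T) → Γ ⊢ (□ A ⟶ □ ⊔ A)
    □⟶□⊔ A = ⟶T ax4 (K axS)

    -- ⊔ A is necessitated by both of its ⊔I-cases; for □ Aᶜ use ⊔ Aᶜ = ⊔ A.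
    ⊔⟶□⊔ : (A : Term T) → Γ ⊢ (⊔ A ⟶ □ ⊔ A)
    ⊔⟶□⊔ A = ⊔I (□⟶□⊔ A)
                (⊔Ex (□⟶□⊔ (A ᶜ)) (univ (≈u-refl (□ (A ᶜ))) (cng□ (elim (≈u-refl A)))))

    ◇⊖⟶⊖ : (A : Term T) → Γ ⊢ (◇ ⊖ A ⟶ ⊖ A)
    ◇⊖⟶⊖ A = cEx (⟶-contrapose (⊔⟶□⊔ A))
                 (univ (cngᶜ (cng□ (intro (≈c-refl (⊔ A))))) (≈c-refl (⊖ A)))

    ⊖-intro : {A B : Term T} → Γ ⊢ (A ⟶ ◇ B) → Γ ⊢ (A ⟶ ◇ (B ᶜ)) → Γ ⊢ (A ⟶ ⊖ B)
    ⊖-intro {A} {B} d e =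
      cC (⊔I (cEx (cC e) (univ (cng□ (elim (≈c-refl B))) (≈c-refl (A ᶜ)))) (cC d))

    ⇝-mono : {A A′ B B′ : Term T} →
             Γ ⊢ (A ⇝ B) → Γ ⊢ (A ⟶ A′) → Γ ⊢ (B ⟶ B′) → Γ ⊢ (A′ ⇝ B′)
    ⇝-mono d f g = ⇝C (⇝T (⇝C (⇝T d g)) f)

    ⋆-◇ : {A : Term T} → Γ ⊢ ⋆ A → Γ ⊢ ⋆ (◇ A)
    ⋆-◇ {A} d = ⇝-mono d (⟶◇ A) (⟶◇ A)

    ⋆-□ : {A : Term T} → Γ ⊢ ⋆ (□ A) → Γ ⊢ ⋆ A
    ⋆-□ d = ⇝-mono d axT axT

    ⇝K : {A B : Term T} → Γ ⊢ (A ⇝ B) → Γ ⊢ (◇ A ⇝ ◇ B)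
    ⇝K {A} {B} d = ⇝-mono d (⟶◇ A) (⟶◇ B)

lemma2p3 : {T : Set} →
    ((A : Term T) →
        ([] ⊢ (⊖ A ⟶ ◇ (A ᶜ)))
      × ([] ⊢ (A ⟶ ◇ A))
      × ([] ⊢ (⊖ A ⟶ ◇ A))
      × ([] ⊢ (□ (A ᶜ) ⟶ ⊔ A))
      × ([] ⊢ (◇ ◇ A ⟶ ◇ A))
      × ([] ⊢ (◇ ⊖ A ⟶ ⊖ A))
      × ([] ⊢ (◇ □ A ⟶ ◇ A)))
  × ((φ ψ : Formula T) → Lift _≈o_ φ ψ → (φ ∷ []) ⊢ ψ)
  × ((A B : Term T) →
        ((⋆ A ∷ []) ⊢ ⋆ (◇ A))
      × ((⋆ (□ A) ∷ []) ⊢ ⋆ A)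
      × ((⋆ A ∷ (A ⟶ B) ∷ []) ⊢ (A ⇝ B))
      × (((A ⟶ ◇ B) ∷ (A ⟶ ◇ (B ᶜ)) ∷ []) ⊢ (A ⟶ ⊖ B))
      × (((A ⟶ B) ∷ []) ⊢ (◇ A ⟶ ◇ B))
      × (((A ⟶ ◇ B) ∷ []) ⊢ (◇ A ⟶ ◇ B))
      × (((A ⇝ B) ∷ []) ⊢ (◇ A ⇝ ◇ B))
      × (((A ⟶ □ B) ∷ []) ⊢ (□ A ⟶ □ B)))
lemma2p3 =
    (λ A → ⊖⟶◇ᶜ A , ⟶◇ A , ⊖⟶◇ A , □ᶜ⟶⊔ A , ◇◇⟶◇ A , ◇⊖⟶⊖ A , ◇□⟶◇ A)
  , (λ φ ψ p → ⊖Ex first p)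
  , λ A B → ⋆-◇ first , ⋆-□ first , ⇝T first second , ⊖-intro first second
          , ◇-mono first , ◇-lift first , ⇝K first , □-lift first
  where
  first : ∀ {T} {φ : Formula T} {Γ} → (φ ∷ Γ) ⊢ φ
  first = hyp (here refl)

  second : ∀ {T} {φ ψ : Formula T} {Γ} → (φ ∷ ψ ∷ Γ) ⊢ ψ
  second = hyp (there (here refl))
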